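{- The Thue–Morse morphism $\mu$ is interference-free on $\mathcal{L}_T=\{T_i:i\ge4\}$.
   Context: $\mu(\mathtt{a})=\mathtt{ab}$, $\mu(\mathtt{b})=\mathtt{ba}$ (an injective morphism), and $T_i=\mu^{i-1}(\mathtt{a})$. Images are $\mu(\mathtt{a}),\mu(\mathtt{b})$. A word admits an image factorization if it is a concatenation of zero or more images. A word $w$ admits an interfered image factorization if $w=xyz$ with $x$ a proper (possibly empty) suffix of some image, $y$ admitting an image factorization, $z$ a proper (possibly empty) prefix of some image, and $xz\neq\varepsilon$. A word is an inner image factor if it is a proper factor of some image that is neither a prefix nor a suffix of it. An injective morphism is interference-free on $\mathcal{L}$ if for every non-empty $u\in\mathcal{L}$, the image of $u$ admits no interfered image factorization and is not an inner image factor. -}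

module Defs where

open import Data.List using (List; []; _∷_; _++_; concatMap)
open import Data.Nat using (ℕ; zero; suc; _≤_)
open import Data.Product using (Σ; ∃; ∃-syntax; _×_; _,_)
open import Relation.Binary.PropositionalEquality using (_≡_)
open import Relation.Nullary using (¬_)

data Letter : Set where
  a b : Letter

Word : Set
Word = List Letter

μ₁ : Letter → Word
μ₁ a = a ∷ b ∷ []
μ₁ b = b ∷ a ∷ []

μ : Word → Word
μ = concatMap μ₁

-- T_i = μ^{i-1}(a), indexed by i ≥ 1; here T (suc k) = μ^k(a)
μ^ : ℕ → Word → Word
μ^ zero w = w
μ^ (suc k) w = μ (μ^ k w)

T : ℕ → Word
T zero = a ∷ []   -- unused junk value (T is only used for indices ≥ 1)
T (suc k) = μ^ k (a ∷ [])

IsImage : Word → Set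
IsImage w = ∃[ c ] (w ≡ μ₁ c)

data ImageFactorization : Word → Set where
  []ᶠ  : ImageFactorization []
  _∷ᶠ_ : ∀ {u w} → IsImage u → ImageFactorization w → ImageFactorization (u ++ w)

ProperSuffixOfImage : Word → Set
ProperSuffixOfImage x = ∃[ c ] ∃[ p ] (¬ (p ≡ []) × (p ++ x ≡ μ₁ c))

ProperPrefixOfImage : Word → Set
ProperPrefixOfImage z = ∃[ c ] ∃[ s ] (¬ (s ≡ []) × (z ++ s ≡ μ₁ c))

InterferedImageFactorization : Word → Set
InterferedImageFactorization w =
  ∃[ x ] ∃[ y ] ∃[ z ]
    ((w ≡ x ++ y ++ z) × ProperSuffixOfImage x × ImageFactorization y
      × ProperPrefixOfImage z × ¬ (x ++ z ≡ []))

InnerImageFactor : Word → Set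
InnerImageFactor w =
  ∃[ c ] ((∃[ p ] ∃[ s ] (p ++ w ++ s ≡ μ₁ c)) × ¬ (w ≡ μ₁ c)
          × ¬ (∃[ s ] (w ++ s ≡ μ₁ c)) × ¬ (∃[ p ] (p ++ w ≡ μ₁ c)))

Language : Set₁
Language = Word → Set

InterferenceFree : Language → Set
InterferenceFree L =
  ∀ u → L u → ¬ (u ≡ []) →
    ¬ InterferedImageFactorization (μ u) × ¬ InnerImageFactor (μ u)

L-T : Language
L-T w = ∃[ i ] ((4 ≤ i) × (w ≡ T i))

-- A proper suffix or prefix of an image has at most one letter, and image
-- factorizations have even length.  So in an interfered factorization x y z
-- of an image-factorizable word w, either x is empty and z a single letter,
-- which breaks parity, or x is a single letter and the images of y start at
-- the second letter of w.  The latter is impossible once the second and third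
-- letters of w coincide, as they do in μ(T i) = T (i + 1), which begins with
-- abba for i ≥ 2.  Inner image factors, finally, have at most one letter.
module Submission where

open import Defs
open import Data.List using (List; []; _∷_; _++_; [_]; length)
open import Data.List.Properties using (∷-injectiveʳ; length-++)
open import Data.Nat using (suc; _+_; s≤s; z≤n)
open import Data.Nat.Divisibility using (_∣_; ∣-refl; ∣m∣n⇒∣m+n; ∣m+n∣m⇒∣n; ∣1⇒≡1; divides-refl)
open import Data.Product using (∃-syntax; _,_)
open import Data.Empty using (⊥)
open import Relation.Binary.PropositionalEquality using (_≡_; refl; sym; trans; cong; subst)
open import Relation.Nullary using (¬_)

μ-factorization : ∀ v → ImageFactorization (μ v)
μ-factorization []      = []ᶠ
μ-factorization (c ∷ v) = (c , refl) ∷ᶠ μ-factorization v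

factorization-even : ∀ {y} → ImageFactorization y → 2 ∣ length y
factorization-even []ᶠ = divides-refl 0
factorization-even ((c , refl) ∷ᶠ fw) =
  subst (2 ∣_) (sym (length-++ (μ₁ c))) (∣m∣n⇒∣m+n (image-even c) (factorization-even fw))
  where
  image-even : ∀ c → 2 ∣ length (μ₁ c)
  image-even a = ∣-refl
  image-even b = ∣-refl

factorization≢factorization∷ʳ : ∀ {w y c} → ImageFactorization w → ImageFactorization y →
  ¬ (w ≡ y ++ [ c ])
factorization≢factorization∷ʳ {y = y} {c} fw fy refl with
  ∣1⇒≡1 (∣m+n∣m⇒∣n (subst (2 ∣_) (length-++ y) (factorization-even fw))
                   (factorization-even fy))
... | ()

¬proper-suffix-of-image : ∀ {e f x} → ¬ ProperSuffixOfImage (e ∷ f ∷ x)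
¬proper-suffix-of-image (_ , []            , p≢[] , _) = p≢[] refl
¬proper-suffix-of-image (a , _ ∷ []        , _ , ())
¬proper-suffix-of-image (b , _ ∷ []        , _ , ())
¬proper-suffix-of-image (a , _ ∷ _ ∷ []    , _ , ())
¬proper-suffix-of-image (b , _ ∷ _ ∷ []    , _ , ())
¬proper-suffix-of-image (a , _ ∷ _ ∷ _ ∷ _ , _ , ())
¬proper-suffix-of-image (b , _ ∷ _ ∷ _ ∷ _ , _ , ())

¬proper-prefix-of-image : ∀ {e f z} → ¬ ProperPrefixOfImage (e ∷ f ∷ z)
¬proper-prefix-of-image {z = []}    (a , [] , s≢[] , _) = s≢[] refl
¬proper-prefix-of-image {z = []}    (b , [] , s≢[] , _) = s≢[] refl
¬proper-prefix-of-image {z = []}    (a , _ ∷ _ , _ , ())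
¬proper-prefix-of-image {z = []}    (b , _ ∷ _ , _ , ())
¬proper-prefix-of-image {z = _ ∷ _} (a , _ , _ , ())
¬proper-prefix-of-image {z = _ ∷ _} (b , _ , _ , ())

long-factor-of-pair : ∀ {A : Set} {p s w : List A} {e f x y} →
  p ++ (e ∷ f ∷ w) ++ s ≡ x ∷ y ∷ [] → e ∷ f ∷ w ≡ x ∷ y ∷ []
long-factor-of-pair {p = []}            {s = []}    {w = []} refl = refl
long-factor-of-pair {p = []}            {s = _ ∷ _} {w = []} ()
long-factor-of-pair {p = []}                        {w = _ ∷ _} ()
long-factor-of-pair {p = _ ∷ []}                    ()
long-factor-of-pair {p = _ ∷ _ ∷ []}                ()
long-factor-of-pair {p = _ ∷ _ ∷ _ ∷ _}             ()

¬inner-image-factor : ∀ {e f w} → ¬ InnerImageFactor (e ∷ f ∷ w)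
¬inner-image-factor (a , (_ , _ , factor) , w≢image , _) = w≢image (long-factor-of-pair factor)
¬inner-image-factor (b , (_ , _ , factor) , w≢image , _) = w≢image (long-factor-of-pair factor)

factorization-prefix≢square : ∀ {y z c r} → ImageFactorization y → ProperPrefixOfImage z →
  ¬ (y ++ z ≡ c ∷ c ∷ r)
factorization-prefix≢square []ᶠ pz refl = ¬proper-prefix-of-image pz
factorization-prefix≢square ((a , refl) ∷ᶠ _) _ ()
factorization-prefix≢square ((b , refl) ∷ᶠ _) _ ()

¬interfered-factorization : ∀ {w e c r} → ImageFactorization w → w ≡ e ∷ c ∷ c ∷ r →
  ¬ InterferedImageFactorization w
¬interfered-factorization {w} fw w≡ecc (x , y , z , w≡xyz , sx , fy , pz , xz≢[]) =
  refute x z w≡xyz sx pz xz≢[]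
  where
  refute : ∀ x z → w ≡ x ++ y ++ z → ProperSuffixOfImage x → ProperPrefixOfImage z →
    ¬ (x ++ z ≡ []) → ⊥
  refute (_ ∷ _ ∷ _) _ _ sx _ _ = ¬proper-suffix-of-image sx
  refute (_ ∷ []) _ w≡xyz _ pz _ =
    factorization-prefix≢square fy pz (∷-injectiveʳ (trans (sym w≡xyz) w≡ecc))
  refute [] []          _     _ _  xz≢[] = xz≢[] refl
  refute [] (_ ∷ [])    w≡yz  _ _  _     = factorization≢factorization∷ʳ fw fy w≡yz
  refute [] (_ ∷ _ ∷ _) _     _ pz _     = ¬proper-prefix-of-image pz

μ^-abba-prefix : ∀ k → ∃[ r ] (μ^ (2 + k) [ a ] ≡ a ∷ b ∷ b ∷ a ∷ r)
μ^-abba-prefix 0       = [] , refl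
μ^-abba-prefix (suc k) with μ^-abba-prefix k
... | r , eq = b ∷ a ∷ a ∷ b ∷ μ r , cong μ eq

corollary14 : InterferenceFree L-T
corollary14 _ (suc (suc (suc (suc k))) , s≤s (s≤s (s≤s (s≤s z≤n))) , refl) _
  with μ^-abba-prefix (2 + k)
... | _ , μu≡abba =
  ¬interfered-factorization (μ-factorization (μ^ (3 + k) [ a ])) μu≡abba
  , subst (λ w → ¬ InnerImageFactor w) (sym μu≡abba) ¬inner-image-factor
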